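{- Let $\Gamma$ be a set of propositions, $A$ a proposition and $x$ a variable that is free neither in $\Gamma$ nor in $A$. If the sequent $\mathrm{HA}_N, \Gamma, N(x)\vdash A$ is provable, then the sequent $\mathrm{HA}_N,\Gamma\vdash A$ is provable.
   Context: Provability is in intuitionistic natural deduction; $\mathrm{HA}_N$ in a sequent stands for the set of axioms of $\mathrm{HA}_N$. $\mathrm{HA}_N$ is the one-sorted theory over the language $0, S, +, \times, =, Pred, Null, N$ ($Null$ and $N$ unary predicates) whose axioms are: the axioms of equality for all these symbols; the relativized induction scheme $(0/x)P \Rightarrow \forall y~(N(y) \Rightarrow (y/x)P \Rightarrow (S(y)/x)P) \Rightarrow \forall n~(N(n) \Rightarrow (n/x)P)$ for every proposition $P$ of this language; $N(0)$, $\forall x~(N(x)\Rightarrow N(S(x)))$, $Pred(0)=0$, $\forall x~(Pred(S(x))=x)$, $Null(0)$, $\forall x~\neg Null(S(x))$, $\forall y~(0+y=y)$, $\forall x\forall y~(S(x)+y=S(x+y))$, $\forall y~(0\times y=0)$, $\forall x\forall y~(S(x)\times y=x\times y+y)$. -}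

module Defs where

open import Data.Nat using (ℕ; zero; suc)
open import Data.Empty using (⊥)
open import Data.Unit using (⊤)
open import Data.Sum using (_⊎_)
open import Data.Product using (Σ; _×_)
open import Relation.Binary.PropositionalEquality using (_≡_)

infixl 6 _⊕_
infixl 7 _⊗_

data Term : Set where
  var  : ℕ → Term
  `0   : Term
  `S   : Term → Term
  _⊕_  : Term → Term → Term
  _⊗_  : Term → Term → Term
  `Pred : Term → Term

infix  4 _≐_
infixr 2 _⇒_
infixr 3 _∧'_
infixr 3 _∨'_

data Formula : Set where
  _≐_   : Term → Term → Formula
  Null  : Term → Formula
  Nat   : Term → Formula
  ⊤'    : Formula
  ⊥'    : Formula
  _⇒_   : Formula → Formula → Formula
  _∧'_  : Formula → Formula → Formula
  _∨'_  : Formula → Formula → Formula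
  ∀'    : Formula → Formula
  ∃'    : Formula → Formula

¬' : Formula → Formula
¬' A = A ⇒ ⊥'

ext : (ℕ → ℕ) → ℕ → ℕ
ext ρ zero    = zero
ext ρ (suc n) = suc (ρ n)

renT : (ℕ → ℕ) → Term → Term
renT ρ (var n)   = var (ρ n)
renT ρ `0        = `0
renT ρ (`S t)    = `S (renT ρ t)
renT ρ (t ⊕ u)   = renT ρ t ⊕ renT ρ u
renT ρ (t ⊗ u)   = renT ρ t ⊗ renT ρ u
renT ρ (`Pred t) = `Pred (renT ρ t)

renF : (ℕ → ℕ) → Formula → Formula
renF ρ (t ≐ u)  = renT ρ t ≐ renT ρ u
renF ρ (Null t) = Null (renT ρ t)
renF ρ (Nat t)  = Nat (renT ρ t)
renF ρ ⊤'       = ⊤'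
renF ρ ⊥'       = ⊥'
renF ρ (A ⇒ B)  = renF ρ A ⇒ renF ρ B
renF ρ (A ∧' B) = renF ρ A ∧' renF ρ B
renF ρ (A ∨' B) = renF ρ A ∨' renF ρ B
renF ρ (∀' A)   = ∀' (renF (ext ρ) A)
renF ρ (∃' A)   = ∃' (renF (ext ρ) A)

↑F : Formula → Formula
↑F = renF suc

exts : (ℕ → Term) → ℕ → Term
exts σ zero    = var zero
exts σ (suc n) = renT suc (σ n)

subT : (ℕ → Term) → Term → Term
subT σ (var n)   = σ n
subT σ `0        = `0
subT σ (`S t)    = `S (subT σ t)
subT σ (t ⊕ u)   = subT σ t ⊕ subT σ u
subT σ (t ⊗ u)   = subT σ t ⊗ subT σ u
subT σ (`Pred t) = `Pred (subT σ t)

subF : (ℕ → Term) → Formula → Formula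
subF σ (t ≐ u)  = subT σ t ≐ subT σ u
subF σ (Null t) = Null (subT σ t)
subF σ (Nat t)  = Nat (subT σ t)
subF σ ⊤'       = ⊤'
subF σ ⊥'       = ⊥'
subF σ (A ⇒ B)  = subF σ A ⇒ subF σ B
subF σ (A ∧' B) = subF σ A ∧' subF σ B
subF σ (A ∨' B) = subF σ A ∨' subF σ B
subF σ (∀' A)   = ∀' (subF (exts σ) A)
subF σ (∃' A)   = ∃' (subF (exts σ) A)

-- A [ t ]: substitute t for the de Bruijn index 0 (the variable bound by
-- the surrounding quantifier) and lower the other free variables by one.
_∷ₛ_ : Term → (ℕ → Term) → ℕ → Term
(t ∷ₛ σ) zero    = t
(t ∷ₛ σ) (suc n) = σ n

_[_] : Formula → Term → Formula
A [ t ] = subF (t ∷ₛ var) A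

FreeT : ℕ → Term → Set
FreeT x (var n)   = x ≡ n
FreeT x `0        = ⊥
FreeT x (`S t)    = FreeT x t
FreeT x (t ⊕ u)   = FreeT x t ⊎ FreeT x u
FreeT x (t ⊗ u)   = FreeT x t ⊎ FreeT x u
FreeT x (`Pred t) = FreeT x t

FreeF : ℕ → Formula → Set
FreeF x (t ≐ u)  = FreeT x t ⊎ FreeT x u
FreeF x (Null t) = FreeT x t
FreeF x (Nat t)  = FreeT x t
FreeF x ⊤'       = ⊥
FreeF x ⊥'       = ⊥
FreeF x (A ⇒ B)  = FreeF x A ⊎ FreeF x B
FreeF x (A ∧' B) = FreeF x A ⊎ FreeF x B
FreeF x (A ∨' B) = FreeF x A ⊎ FreeF x B
FreeF x (∀' A)   = FreeF (suc x) A
FreeF x (∃' A)   = FreeF (suc x) A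

Theory : Set₁
Theory = Formula → Set

_∪_ : Theory → Theory → Theory
(Γ ∪ Δ) A = Γ A ⊎ Δ A

｛_｝ : Formula → Theory
｛ A ｝ B = B ≡ A

↑T : Theory → Theory
↑T Γ B = Σ Formula (λ C → Γ C × (B ≡ ↑F C))

infix 1 _⊢_

data _⊢_ (Γ : Theory) : Formula → Set where
  ax    : ∀ {A} → Γ A → Γ ⊢ A
  ⊤I    : Γ ⊢ ⊤'
  ⊥E    : ∀ {A} → Γ ⊢ ⊥' → Γ ⊢ A
  ⇒I    : ∀ {A B} → (Γ ∪ ｛ A ｝) ⊢ B → Γ ⊢ A ⇒ B
  ⇒E    : ∀ {A B} → Γ ⊢ A ⇒ B → Γ ⊢ A → Γ ⊢ B
  ∧I    : ∀ {A B} → Γ ⊢ A → Γ ⊢ B → Γ ⊢ A ∧' B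
  ∧E₁   : ∀ {A B} → Γ ⊢ A ∧' B → Γ ⊢ A
  ∧E₂   : ∀ {A B} → Γ ⊢ A ∧' B → Γ ⊢ B
  ∨I₁   : ∀ {A B} → Γ ⊢ A → Γ ⊢ A ∨' B
  ∨I₂   : ∀ {A B} → Γ ⊢ B → Γ ⊢ A ∨' B
  ∨E    : ∀ {A B C} → Γ ⊢ A ∨' B → (Γ ∪ ｛ A ｝) ⊢ C → (Γ ∪ ｛ B ｝) ⊢ C → Γ ⊢ C
  -- ∀-intro: the eigenvariable (index 0) is fresh for Γ by construction
  ∀I    : ∀ {A} → ↑T Γ ⊢ A → Γ ⊢ ∀' A
  ∀E    : ∀ {A} (t : Term) → Γ ⊢ ∀' A → Γ ⊢ A [ t ]
  ∃I    : ∀ {A} (t : Term) → Γ ⊢ A [ t ] → Γ ⊢ ∃' A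
  -- ∃-elim: the witness (index 0) is fresh for Γ and for C
  ∃E    : ∀ {A C} → Γ ⊢ ∃' A → (↑T Γ ∪ ｛ A ｝) ⊢ ↑F C → Γ ⊢ C

private
  v0 v1 v2 v3 : Term
  v0 = var 0
  v1 = var 1
  v2 = var 2
  v3 = var 3

-- instance of the relativized induction scheme for P, where the de Bruijn
-- index 0 of P plays the role of the variable x (other free variables of P
-- are parameters):
-- (0/x)P ⇒ ∀y (N(y) ⇒ (y/x)P ⇒ (S(y)/x)P) ⇒ ∀n (N(n) ⇒ (n/x)P)
Induction : Formula → Formula
Induction P =
  P [ `0 ]
  ⇒ ∀' (Nat v0 ⇒ P ⇒ subF (`S v0 ∷ₛ (λ k → var (suc k))) P)
  ⇒ ∀' (Nat v0 ⇒ P)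

data HA : Theory where
  eq-refl  : HA (∀' (v0 ≐ v0))
  eq-S     : HA (∀' (∀' (v1 ≐ v0 ⇒ `S v1 ≐ `S v0)))
  eq-Pred  : HA (∀' (∀' (v1 ≐ v0 ⇒ `Pred v1 ≐ `Pred v0)))
  eq-+     : HA (∀' (∀' (∀' (∀' (v3 ≐ v2 ⇒ v1 ≐ v0 ⇒ v3 ⊕ v1 ≐ v2 ⊕ v0)))))
  eq-×     : HA (∀' (∀' (∀' (∀' (v3 ≐ v2 ⇒ v1 ≐ v0 ⇒ v3 ⊗ v1 ≐ v2 ⊗ v0)))))
  eq-=     : HA (∀' (∀' (∀' (∀' (v3 ≐ v2 ⇒ v1 ≐ v0 ⇒ v3 ≐ v1 ⇒ v2 ≐ v0)))))
  eq-Null  : HA (∀' (∀' (v1 ≐ v0 ⇒ Null v1 ⇒ Null v0)))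
  eq-N     : HA (∀' (∀' (v1 ≐ v0 ⇒ Nat v1 ⇒ Nat v0)))
  ind      : ∀ P → HA (Induction P)
  N0       : HA (Nat `0)
  NS       : HA (∀' (Nat v0 ⇒ Nat (`S v0)))
  pred0    : HA (`Pred `0 ≐ `0)
  predS    : HA (∀' (`Pred (`S v0) ≐ v0))
  null0    : HA (Null `0)
  nullS    : HA (∀' (¬' (Null (`S v0))))
  plus0    : HA (∀' (`0 ⊕ v0 ≐ v0))
  plusS    : HA (∀' (∀' (`S v1 ⊕ v0 ≐ `S (v1 ⊕ v0))))
  times0   : HA (∀' (`0 ⊗ v0 ≐ `0))
  timesS   : HA (∀' (∀' (`S v1 ⊗ v0 ≐ v1 ⊗ v0 ⊕ v0)))

module Submission where

-- Substitute 0 for x throughout the derivation. Γ and A are unchanged since x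
-- is not free in them, the axioms of HA_N are closed under substitution (an
-- instance of the induction scheme becomes another instance), and the
-- hypothesis N(x) becomes the axiom N(0). Because ∀I and ∃E introduce their
-- eigenvariable by shifting the context, substituting into a derivation
-- requires renaming derivations as well.

open import Defs
open import Data.Nat using (ℕ; zero; suc; _≟_)
open import Data.Empty using (⊥-elim)
open import Data.Sum using (inj₁; inj₂)
open import Data.Product using (_,_)
open import Function using (_∘_)
open import Relation.Nullary using (¬_; yes; no)
open import Relation.Binary.PropositionalEquality
  using (_≡_; _≢_; refl; sym; trans; cong; cong₂; subst; module ≡-Reasoning)

open ≡-Reasoning

Substitution : Set
Substitution = ℕ → Term

_≗ₛ_ : Substitution → Substitution → Set
σ ≗ₛ τ = ∀ n → σ n ≡ τ n

subT-cong : ∀ {σ τ} → σ ≗ₛ τ → ∀ t → subT σ t ≡ subT τ t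
subT-cong e (var n)   = e n
subT-cong e `0        = refl
subT-cong e (`S t)    = cong `S (subT-cong e t)
subT-cong e (t ⊕ u)   = cong₂ _⊕_ (subT-cong e t) (subT-cong e u)
subT-cong e (t ⊗ u)   = cong₂ _⊗_ (subT-cong e t) (subT-cong e u)
subT-cong e (`Pred t) = cong `Pred (subT-cong e t)

exts-cong : ∀ {σ τ} → σ ≗ₛ τ → exts σ ≗ₛ exts τ
exts-cong e zero    = refl
exts-cong e (suc n) = cong (renT suc) (e n)

subF-cong : ∀ {σ τ} → σ ≗ₛ τ → ∀ A → subF σ A ≡ subF τ A
subF-cong e (t ≐ u)  = cong₂ _≐_ (subT-cong e t) (subT-cong e u)
subF-cong e (Null t) = cong Null (subT-cong e t)
subF-cong e (Nat t)  = cong Nat (subT-cong e t)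
subF-cong e ⊤'       = refl
subF-cong e ⊥'       = refl
subF-cong e (A ⇒ B)  = cong₂ _⇒_ (subF-cong e A) (subF-cong e B)
subF-cong e (A ∧' B) = cong₂ _∧'_ (subF-cong e A) (subF-cong e B)
subF-cong e (A ∨' B) = cong₂ _∨'_ (subF-cong e A) (subF-cong e B)
subF-cong e (∀' A)   = cong ∀' (subF-cong (exts-cong e) A)
subF-cong e (∃' A)   = cong ∃' (subF-cong (exts-cong e) A)

subT-id : ∀ t → subT var t ≡ t
subT-id (var n)   = refl
subT-id `0        = refl
subT-id (`S t)    = cong `S (subT-id t)
subT-id (t ⊕ u)   = cong₂ _⊕_ (subT-id t) (subT-id u)
subT-id (t ⊗ u)   = cong₂ _⊗_ (subT-id t) (subT-id u)
subT-id (`Pred t) = cong `Pred (subT-id t)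

renT-as-subT : ∀ ρ t → renT ρ t ≡ subT (var ∘ ρ) t
renT-as-subT ρ (var n)   = refl
renT-as-subT ρ `0        = refl
renT-as-subT ρ (`S t)    = cong `S (renT-as-subT ρ t)
renT-as-subT ρ (t ⊕ u)   = cong₂ _⊕_ (renT-as-subT ρ t) (renT-as-subT ρ u)
renT-as-subT ρ (t ⊗ u)   = cong₂ _⊗_ (renT-as-subT ρ t) (renT-as-subT ρ u)
renT-as-subT ρ (`Pred t) = cong `Pred (renT-as-subT ρ t)

renF-as-subF : ∀ ρ A → renF ρ A ≡ subF (var ∘ ρ) A
renF-as-subF ρ (t ≐ u)  = cong₂ _≐_ (renT-as-subT ρ t) (renT-as-subT ρ u)
renF-as-subF ρ (Null t) = cong Null (renT-as-subT ρ t)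
renF-as-subF ρ (Nat t)  = cong Nat (renT-as-subT ρ t)
renF-as-subF ρ ⊤'       = refl
renF-as-subF ρ ⊥'       = refl
renF-as-subF ρ (A ⇒ B)  = cong₂ _⇒_ (renF-as-subF ρ A) (renF-as-subF ρ B)
renF-as-subF ρ (A ∧' B) = cong₂ _∧'_ (renF-as-subF ρ A) (renF-as-subF ρ B)
renF-as-subF ρ (A ∨' B) = cong₂ _∨'_ (renF-as-subF ρ A) (renF-as-subF ρ B)
renF-as-subF ρ (∀' A)   = cong ∀' (trans (renF-as-subF (ext ρ) A) (subF-cong var-ext A))
  where
  var-ext : (var ∘ ext ρ) ≗ₛ exts (var ∘ ρ)
  var-ext zero    = refl
  var-ext (suc n) = refl
renF-as-subF ρ (∃' A)   = cong ∃' (trans (renF-as-subF (ext ρ) A) (subF-cong var-ext A))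
  where
  var-ext : (var ∘ ext ρ) ≗ₛ exts (var ∘ ρ)
  var-ext zero    = refl
  var-ext (suc n) = refl

subT-subT : ∀ σ τ t → subT σ (subT τ t) ≡ subT (subT σ ∘ τ) t
subT-subT σ τ (var n)   = refl
subT-subT σ τ `0        = refl
subT-subT σ τ (`S t)    = cong `S (subT-subT σ τ t)
subT-subT σ τ (t ⊕ u)   = cong₂ _⊕_ (subT-subT σ τ t) (subT-subT σ τ u)
subT-subT σ τ (t ⊗ u)   = cong₂ _⊗_ (subT-subT σ τ t) (subT-subT σ τ u)
subT-subT σ τ (`Pred t) = cong `Pred (subT-subT σ τ t)

subT-renT : ∀ σ ρ t → subT σ (renT ρ t) ≡ subT (σ ∘ ρ) t
subT-renT σ ρ t = trans (cong (subT σ) (renT-as-subT ρ t)) (subT-subT σ (var ∘ ρ) t)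

renT-subT : ∀ ρ σ t → renT ρ (subT σ t) ≡ subT (renT ρ ∘ σ) t
renT-subT ρ σ t = begin
  renT ρ (subT σ t)               ≡⟨ renT-as-subT ρ (subT σ t) ⟩
  subT (var ∘ ρ) (subT σ t)       ≡⟨ subT-subT (var ∘ ρ) σ t ⟩
  subT (subT (var ∘ ρ) ∘ σ) t     ≡⟨ subT-cong (λ n → sym (renT-as-subT ρ (σ n))) t ⟩
  subT (renT ρ ∘ σ) t             ∎

exts-exts : ∀ σ τ → (subT (exts σ) ∘ exts τ) ≗ₛ exts (subT σ ∘ τ)
exts-exts σ τ zero    = refl
exts-exts σ τ (suc n) = trans (subT-renT (exts σ) suc (τ n)) (sym (renT-subT suc σ (τ n)))

subF-subF : ∀ σ τ A → subF σ (subF τ A) ≡ subF (subT σ ∘ τ) A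
subF-subF σ τ (t ≐ u)  = cong₂ _≐_ (subT-subT σ τ t) (subT-subT σ τ u)
subF-subF σ τ (Null t) = cong Null (subT-subT σ τ t)
subF-subF σ τ (Nat t)  = cong Nat (subT-subT σ τ t)
subF-subF σ τ ⊤'       = refl
subF-subF σ τ ⊥'       = refl
subF-subF σ τ (A ⇒ B)  = cong₂ _⇒_ (subF-subF σ τ A) (subF-subF σ τ B)
subF-subF σ τ (A ∧' B) = cong₂ _∧'_ (subF-subF σ τ A) (subF-subF σ τ B)
subF-subF σ τ (A ∨' B) = cong₂ _∨'_ (subF-subF σ τ A) (subF-subF σ τ B)
subF-subF σ τ (∀' A)   =
  cong ∀' (trans (subF-subF (exts σ) (exts τ) A) (subF-cong (exts-exts σ τ) A))
subF-subF σ τ (∃' A)   =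
  cong ∃' (trans (subF-subF (exts σ) (exts τ) A) (subF-cong (exts-exts σ τ) A))

subF-comm : ∀ σ τ σ′ τ′ → (subT σ ∘ τ) ≗ₛ (subT σ′ ∘ τ′)
          → ∀ A → subF σ (subF τ A) ≡ subF σ′ (subF τ′ A)
subF-comm σ τ σ′ τ′ e A = begin
  subF σ (subF τ A)       ≡⟨ subF-subF σ τ A ⟩
  subF (subT σ ∘ τ) A     ≡⟨ subF-cong e A ⟩
  subF (subT σ′ ∘ τ′) A   ≡⟨ sym (subF-subF σ′ τ′ A) ⟩
  subF σ′ (subF τ′ A)     ∎

renF-renF : ∀ ρ τ A → renF ρ (renF τ A) ≡ renF (ρ ∘ τ) A
renF-renF ρ τ A = begin
  renF ρ (renF τ A)                 ≡⟨ renF-as-subF ρ (renF τ A) ⟩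
  subF (var ∘ ρ) (renF τ A)         ≡⟨ cong (subF (var ∘ ρ)) (renF-as-subF τ A) ⟩
  subF (var ∘ ρ) (subF (var ∘ τ) A) ≡⟨ subF-subF (var ∘ ρ) (var ∘ τ) A ⟩
  subF (var ∘ ρ ∘ τ) A              ≡⟨ sym (renF-as-subF (ρ ∘ τ) A) ⟩
  renF (ρ ∘ τ) A                    ∎

↑F-renF : ∀ ρ C → renF (ext ρ) (↑F C) ≡ ↑F (renF ρ C)
↑F-renF ρ C = trans (renF-renF (ext ρ) suc C) (sym (renF-renF suc ρ C))

↑F-subF : ∀ σ C → ↑F (subF σ C) ≡ subF (exts σ) (↑F C)
↑F-subF σ C = begin
  ↑F (subF σ C)                    ≡⟨ renF-as-subF suc (subF σ C) ⟩
  subF (var ∘ suc) (subF σ C)      ≡⟨ subF-comm (var ∘ suc) σ (exts σ) (var ∘ suc)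
                                        (λ n → sym (renT-as-subT suc (σ n))) C ⟩
  subF (exts σ) (subF (var ∘ suc) C) ≡⟨ cong (subF (exts σ)) (sym (renF-as-subF suc C)) ⟩
  subF (exts σ) (↑F C)             ∎

subF-[] : ∀ σ A t → subF σ (A [ t ]) ≡ subF (exts σ) A [ subT σ t ]
subF-[] σ A t = subF-comm σ (t ∷ₛ var) (subT σ t ∷ₛ var) (exts σ) e A
  where
  e : (subT σ ∘ (t ∷ₛ var)) ≗ₛ (subT (subT σ t ∷ₛ var) ∘ exts σ)
  e zero    = refl
  e (suc n) = sym (trans (subT-renT (subT σ t ∷ₛ var) suc (σ n)) (subT-id (σ n)))

renF-[] : ∀ ρ A t → renF ρ (A [ t ]) ≡ renF (ext ρ) A [ renT ρ t ]
renF-[] ρ A t = begin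
  renF ρ (A [ t ])                         ≡⟨ renF-as-subF ρ (A [ t ]) ⟩
  subF (var ∘ ρ) (A [ t ])                 ≡⟨ subF-comm (var ∘ ρ) (t ∷ₛ var)
                                                (renT ρ t ∷ₛ var) (var ∘ ext ρ) e A ⟩
  subF (var ∘ ext ρ) A [ renT ρ t ]        ≡⟨ cong (_[ renT ρ t ]) (sym (renF-as-subF (ext ρ) A)) ⟩
  renF (ext ρ) A [ renT ρ t ]              ∎
  where
  e : (subT (var ∘ ρ) ∘ (t ∷ₛ var)) ≗ₛ (subT (renT ρ t ∷ₛ var) ∘ var ∘ ext ρ)
  e zero    = sym (renT-as-subT ρ t)
  e (suc n) = refl

subF-Induction : ∀ σ P → subF σ (Induction P) ≡ Induction (subF (exts σ) P)
subF-Induction σ P = cong₂ _⇒_ (subF-[] σ P `0) (cong (λ Q → step Q ⇒ conclusion) successor)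
  where
  P′ : Formula
  P′ = subF (exts σ) P
  step : Formula → Formula
  step Q = ∀' (Nat (var 0) ⇒ P′ ⇒ Q)
  conclusion : Formula
  conclusion = ∀' (Nat (var 0) ⇒ P′)
  next : Substitution
  next = `S (var 0) ∷ₛ (var ∘ suc)
  e : (subT (exts σ) ∘ next) ≗ₛ (subT next ∘ exts σ)
  e zero    = refl
  e (suc n) = trans (renT-as-subT suc (σ n)) (sym (subT-renT next suc (σ n)))
  successor : subF (exts σ) (subF next P) ≡ subF next P′
  successor = subF-comm (exts σ) next next (exts σ) e P

subT-id-on-free : ∀ σ t → (∀ n → FreeT n t → σ n ≡ var n) → subT σ t ≡ t
subT-id-on-free σ (var n)   h = h n refl
subT-id-on-free σ `0        h = refl
subT-id-on-free σ (`S t)    h = cong `S (subT-id-on-free σ t h)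
subT-id-on-free σ (t ⊕ u)   h =
  cong₂ _⊕_ (subT-id-on-free σ t (λ n → h n ∘ inj₁)) (subT-id-on-free σ u (λ n → h n ∘ inj₂))
subT-id-on-free σ (t ⊗ u)   h =
  cong₂ _⊗_ (subT-id-on-free σ t (λ n → h n ∘ inj₁)) (subT-id-on-free σ u (λ n → h n ∘ inj₂))
subT-id-on-free σ (`Pred t) h = cong `Pred (subT-id-on-free σ t h)

exts-id-on-free : ∀ σ {A} → (∀ n → FreeF (suc n) A → σ n ≡ var n)
                → ∀ n → FreeF n A → exts σ n ≡ var n
exts-id-on-free σ h zero    _   = refl
exts-id-on-free σ h (suc n) n∈A = cong (renT suc) (h n n∈A)

subF-id-on-free : ∀ σ A → (∀ n → FreeF n A → σ n ≡ var n) → subF σ A ≡ A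
subF-id-on-free σ (t ≐ u)  h =
  cong₂ _≐_ (subT-id-on-free σ t (λ n → h n ∘ inj₁)) (subT-id-on-free σ u (λ n → h n ∘ inj₂))
subF-id-on-free σ (Null t) h = cong Null (subT-id-on-free σ t h)
subF-id-on-free σ (Nat t)  h = cong Nat (subT-id-on-free σ t h)
subF-id-on-free σ ⊤'       h = refl
subF-id-on-free σ ⊥'       h = refl
subF-id-on-free σ (A ⇒ B)  h =
  cong₂ _⇒_ (subF-id-on-free σ A (λ n → h n ∘ inj₁)) (subF-id-on-free σ B (λ n → h n ∘ inj₂))
subF-id-on-free σ (A ∧' B) h =
  cong₂ _∧'_ (subF-id-on-free σ A (λ n → h n ∘ inj₁)) (subF-id-on-free σ B (λ n → h n ∘ inj₂))
subF-id-on-free σ (A ∨' B) h =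
  cong₂ _∨'_ (subF-id-on-free σ A (λ n → h n ∘ inj₁)) (subF-id-on-free σ B (λ n → h n ∘ inj₂))
subF-id-on-free σ (∀' A)   h = cong ∀' (subF-id-on-free (exts σ) A (exts-id-on-free σ {A} h))
subF-id-on-free σ (∃' A)   h = cong ∃' (subF-id-on-free (exts σ) A (exts-id-on-free σ {A} h))

_≔_ : ℕ → Term → Substitution
(x ≔ t) n with n ≟ x
... | yes _ = t
... | no  _ = var n

≔-self : ∀ x t → (x ≔ t) x ≡ t
≔-self x t with x ≟ x
... | yes _  = refl
... | no x≢x = ⊥-elim (x≢x refl)

≔-other : ∀ {x n} t → n ≢ x → (x ≔ t) n ≡ var n
≔-other {x} {n} t n≢x with n ≟ x
... | yes n≡x = ⊥-elim (n≢x n≡x)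
... | no  _   = refl

subF-≔-fresh : ∀ x t A → ¬ FreeF x A → subF (x ≔ t) A ≡ A
subF-≔-fresh x t A x∉A = subF-id-on-free (x ≔ t) A free-not-x
  where
  free-not-x : ∀ n → FreeF n A → (x ≔ t) n ≡ var n
  free-not-x n n∈A = ≔-other t (λ { refl → x∉A n∈A })

_⊆_ : Theory → Theory → Set
Γ ⊆ Δ = ∀ B → Γ B → Δ B

∪-monoˡ : ∀ {Γ Δ} A → Γ ⊆ Δ → (Γ ∪ ｛ A ｝) ⊆ (Δ ∪ ｛ A ｝)
∪-monoˡ A Γ⊆Δ B (inj₁ g) = inj₁ (Γ⊆Δ B g)
∪-monoˡ A Γ⊆Δ B (inj₂ e) = inj₂ e

↑T-mono : ∀ {Γ Δ} → Γ ⊆ Δ → ↑T Γ ⊆ ↑T Δ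
↑T-mono Γ⊆Δ B (C , g , e) = C , Γ⊆Δ C g , e

⊢-mono : ∀ {Γ Δ A} → Γ ⊆ Δ → Γ ⊢ A → Δ ⊢ A
⊢-mono s (ax g)       = ax (s _ g)
⊢-mono s ⊤I           = ⊤I
⊢-mono s (⊥E d)       = ⊥E (⊢-mono s d)
⊢-mono s (⇒I d)       = ⇒I (⊢-mono (∪-monoˡ _ s) d)
⊢-mono s (⇒E d e)     = ⇒E (⊢-mono s d) (⊢-mono s e)
⊢-mono s (∧I d e)     = ∧I (⊢-mono s d) (⊢-mono s e)
⊢-mono s (∧E₁ d)      = ∧E₁ (⊢-mono s d)
⊢-mono s (∧E₂ d)      = ∧E₂ (⊢-mono s d)
⊢-mono s (∨I₁ d)      = ∨I₁ (⊢-mono s d)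
⊢-mono s (∨I₂ d)      = ∨I₂ (⊢-mono s d)
⊢-mono s (∨E d e f)   = ∨E (⊢-mono s d) (⊢-mono (∪-monoˡ _ s) e) (⊢-mono (∪-monoˡ _ s) f)
⊢-mono s (∀I d)       = ∀I (⊢-mono (↑T-mono s) d)
⊢-mono s (∀E t d)     = ∀E t (⊢-mono s d)
⊢-mono s (∃I t d)     = ∃I t (⊢-mono s d)
⊢-mono s (∃E d e)     = ∃E (⊢-mono s d) (⊢-mono (∪-monoˡ _ (↑T-mono s)) e)

-- A record rather than a function type, so that Γ and Δ are inferable from it.
record Renaming (ρ : ℕ → ℕ) (Γ Δ : Theory) : Set where
  constructor mkRenaming
  field renamed : ∀ B → Γ B → Δ (renF ρ B)
open Renaming

Renaming-∪ : ∀ {ρ Γ Δ} A → Renaming ρ Γ Δ → Renaming ρ (Γ ∪ ｛ A ｝) (Δ ∪ ｛ renF ρ A ｝)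
Renaming-∪ A h = mkRenaming λ { B (inj₁ g) → inj₁ (renamed h B g) ; _ (inj₂ refl) → inj₂ refl }

Renaming-↑ : ∀ {ρ Γ Δ} → Renaming ρ Γ Δ → Renaming (ext ρ) (↑T Γ) (↑T Δ)
Renaming-↑ {ρ} h = mkRenaming λ { _ (C , g , refl) → renF ρ C , renamed h C g , ↑F-renF ρ C }

rename : ∀ {Γ Δ A} ρ → Renaming ρ Γ Δ → Γ ⊢ A → Δ ⊢ renF ρ A
rename ρ h (ax g)     = ax (renamed h _ g)
rename ρ h ⊤I         = ⊤I
rename ρ h (⊥E d)     = ⊥E (rename ρ h d)
rename ρ h (⇒I d)     = ⇒I (rename ρ (Renaming-∪ _ h) d)
rename ρ h (⇒E d e)   = ⇒E (rename ρ h d) (rename ρ h e)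
rename ρ h (∧I d e)   = ∧I (rename ρ h d) (rename ρ h e)
rename ρ h (∧E₁ d)    = ∧E₁ (rename ρ h d)
rename ρ h (∧E₂ d)    = ∧E₂ (rename ρ h d)
rename ρ h (∨I₁ d)    = ∨I₁ (rename ρ h d)
rename ρ h (∨I₂ d)    = ∨I₂ (rename ρ h d)
rename ρ h (∨E d e f) = ∨E (rename ρ h d) (rename ρ (Renaming-∪ _ h) e) (rename ρ (Renaming-∪ _ h) f)
rename ρ h (∀I d)     = ∀I (rename (ext ρ) (Renaming-↑ h) d)
rename ρ h (∀E {A} t d) =
  subst (_ ⊢_) (sym (renF-[] ρ A t)) (∀E (renT ρ t) (rename ρ h d))
rename ρ h (∃I {A} t d) =
  ∃I (renT ρ t) (subst (_ ⊢_) (renF-[] ρ A t) (rename ρ h d))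
rename ρ h (∃E {A} {C} d e) =
  ∃E (rename ρ h d) (subst (_ ⊢_) (↑F-renF ρ C) (rename (ext ρ) (Renaming-∪ A (Renaming-↑ h)) e))

↑⊢ : ∀ {Γ A} → Γ ⊢ A → ↑T Γ ⊢ ↑F A
↑⊢ = rename suc (mkRenaming λ B g → B , g , refl)

Substituting : Substitution → Theory → Theory → Set
Substituting σ Γ Δ = ∀ B → Γ B → Δ ⊢ subF σ B

Substituting-∪ : ∀ {σ Γ Δ} A → Substituting σ Γ Δ → Substituting σ (Γ ∪ ｛ A ｝) (Δ ∪ ｛ subF σ A ｝)
Substituting-∪ A h B (inj₁ g)    = ⊢-mono (λ _ → inj₁) (h B g)
Substituting-∪ A h B (inj₂ refl) = ax (inj₂ refl)

Substituting-↑ : ∀ {σ Γ Δ} → Substituting σ Γ Δ → Substituting (exts σ) (↑T Γ) (↑T Δ)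
Substituting-↑ {σ} h B (C , g , refl) = subst (_ ⊢_) (↑F-subF σ C) (↑⊢ (h C g))

substitute : ∀ {Γ Δ A} σ → Substituting σ Γ Δ → Γ ⊢ A → Δ ⊢ subF σ A
substitute σ h (ax g)     = h _ g
substitute σ h ⊤I         = ⊤I
substitute σ h (⊥E d)     = ⊥E (substitute σ h d)
substitute σ h (⇒I d)     = ⇒I (substitute σ (Substituting-∪ _ h) d)
substitute σ h (⇒E d e)   = ⇒E (substitute σ h d) (substitute σ h e)
substitute σ h (∧I d e)   = ∧I (substitute σ h d) (substitute σ h e)
substitute σ h (∧E₁ d)    = ∧E₁ (substitute σ h d)
substitute σ h (∧E₂ d)    = ∧E₂ (substitute σ h d)
substitute σ h (∨I₁ d)    = ∨I₁ (substitute σ h d)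
substitute σ h (∨I₂ d)    = ∨I₂ (substitute σ h d)
substitute σ h (∨E d e f) =
  ∨E (substitute σ h d) (substitute σ (Substituting-∪ _ h) e) (substitute σ (Substituting-∪ _ h) f)
substitute σ h (∀I d)     = ∀I (substitute (exts σ) (Substituting-↑ h) d)
substitute σ h (∀E {A} t d) =
  subst (_ ⊢_) (sym (subF-[] σ A t)) (∀E (subT σ t) (substitute σ h d))
substitute σ h (∃I {A} t d) =
  ∃I (subT σ t) (subst (_ ⊢_) (subF-[] σ A t) (substitute σ h d))
substitute σ h (∃E {A} {C} d e) =
  ∃E (substitute σ h d)
     (subst (_ ⊢_) (sym (↑F-subF σ C)) (substitute (exts σ) (Substituting-∪ A (Substituting-↑ h)) e))

-- Every axiom but the induction scheme is closed, so subF σ fixes it definitionally.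
HA-subF : ∀ σ {B} → HA B → HA (subF σ B)
HA-subF σ eq-refl = eq-refl
HA-subF σ eq-S    = eq-S
HA-subF σ eq-Pred = eq-Pred
HA-subF σ eq-+    = eq-+
HA-subF σ eq-×    = eq-×
HA-subF σ eq-=    = eq-=
HA-subF σ eq-Null = eq-Null
HA-subF σ eq-N    = eq-N
HA-subF σ (ind P) = subst HA (sym (subF-Induction σ P)) (ind (subF (exts σ) P))
HA-subF σ N0      = N0
HA-subF σ NS      = NS
HA-subF σ pred0   = pred0
HA-subF σ predS   = predS
HA-subF σ null0   = null0
HA-subF σ nullS   = nullS
HA-subF σ plus0   = plus0
HA-subF σ plusS   = plusS
HA-subF σ times0  = times0
HA-subF σ timesS  = timesS

proposition8 : (Γ : Theory) (A : Formula) (x : ℕ)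
    → (∀ B → Γ B → ¬ FreeF x B)
    → ¬ FreeF x A
    → ((HA ∪ Γ) ∪ ｛ Nat (var x) ｝) ⊢ A
    → (HA ∪ Γ) ⊢ A
proposition8 Γ A x x∉Γ x∉A d =
  subst (_ ⊢_) (subF-≔-fresh x `0 A x∉A) (substitute (x ≔ `0) hypotheses d)
  where
  hypotheses : Substituting (x ≔ `0) ((HA ∪ Γ) ∪ ｛ Nat (var x) ｝) (HA ∪ Γ)
  hypotheses B (inj₁ (inj₁ a)) = ax (inj₁ (HA-subF (x ≔ `0) a))
  hypotheses B (inj₁ (inj₂ g)) = subst (_ ⊢_) (sym (subF-≔-fresh x `0 B (x∉Γ B g))) (ax (inj₂ g))
  hypotheses _ (inj₂ refl)     = subst (λ t → _ ⊢ Nat t) (sym (≔-self x `0)) (ax (inj₁ N0))
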